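{- For every positive integer $n$, $$\operatorname{lc}_{\mathfrak{CB}}(K^\star_{n,n})\le \operatorname{lc}_{\mathfrak{CB}}(K_n)\le 2\,\operatorname{lc}_{\mathfrak{CB}}(K^\star_{n,n}),$$ and consequently $\operatorname{lc}_{\mathfrak{CB}}(K^\star_{n,n})=\Theta(\log n)$ as $n\to\infty$.
   Context: For a class $\mathfrak{F}$ of graphs and a graph $H$, an $\mathfrak{F}$-covering of $H$ is a set of subgraphs $G_1,\dots,G_t$ of $H$, each belonging to $\mathfrak{F}$, with $H=G_1\cup\dots\cup G_t$ (every edge of $H$ lies in some $G_i$). It is $k$-local if every vertex of $H$ belongs to at most $k$ of the $G_i$. The local $\mathfrak{F}$-covering number $\operatorname{lc}_{\mathfrak{F}}(H)$ is the least $k$ for which a $k$-local $\mathfrak{F}$-covering of $H$ exists. $\mathfrak{CB}$ denotes the class of complete bipartite graphs. $K_n$ is the complete graph on $n$ vertices, and $K^\star_{n,n}$ is the graph with vertices $a_1,\dots,a_n,b_1,\dots,b_n$ in which $a_ib_j$ is an edge iff $i\ne j$ (i.e., $K_{n,n}$ minus a perfect matching). -}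

module Defs where

open import Data.Nat using (ℕ; _≤_; _+_)
open import Data.Fin using (Fin; splitAt)
open import Data.Fin.Subset using (Subset; _∈_; _∪_)
open import Data.Fin.Subset.Properties using (_∈?_)
open import Data.List using (List; length; filter)
open import Data.List.Relation.Unary.All using (All)
open import Data.List.Relation.Unary.Any using (Any)
open import Data.Product using (Σ; _×_; _,_; proj₁; proj₂)
open import Data.Sum using (_⊎_; inj₁; inj₂)
open import Data.Empty using (⊥)
open import Relation.Binary.PropositionalEquality using (_≡_; _≢_)

-- A (simple, undirected) graph on the vertex set Fin m, given by its
-- edge relation.  All graphs used below have symmetric irreflexive edge relations.
Graph : ℕ → Set₁
Graph m = Fin m → Fin m → Set

K : (n : ℕ) → Graph n
K n u v = u ≢ v

-- K*_{n,n}: vertices Fin (n + n); the first n are a_1..a_n, the last n are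
-- b_1..b_n (via splitAt); a_i b_j is an edge iff i ≠ j.
Kstar : (n : ℕ) → Graph (n + n)
Kstar n u v with splitAt n u | splitAt n v
... | inj₁ i | inj₂ j = i ≢ j
... | inj₂ j | inj₁ i = i ≢ j
... | inj₁ _ | inj₁ _ = ⊥
... | inj₂ _ | inj₂ _ = ⊥

-- A complete bipartite subgraph of H is given by its two (disjoint) sides
-- (A , B): its vertex set is A ∪ B and its edges are all pairs ab, a ∈ A, b ∈ B,
-- all of which must be edges of H.
Piece : ℕ → Set
Piece m = Subset m × Subset m

IsCBSubgraph : ∀ {m} → Graph m → Piece m → Set
IsCBSubgraph {m} H (A , B) =
  (∀ (v : Fin m) → v ∈ A → v ∈ B → ⊥) ×
  (∀ (u v : Fin m) → u ∈ A → v ∈ B → H u v)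

EdgeIn : ∀ {m} → Fin m → Fin m → Piece m → Set
EdgeIn u v (A , B) = (u ∈ A × v ∈ B) ⊎ (v ∈ A × u ∈ B)

Covers : ∀ {m} → Graph m → List (Piece m) → Set
Covers {m} H L = ∀ (u v : Fin m) → H u v → Any (EdgeIn u v) L

load : ∀ {m} → Fin m → List (Piece m) → ℕ
load v L = length (filter (λ p → v ∈? (proj₁ p ∪ proj₂ p)) L)

HasLocalCBCover : ∀ {m} → Graph m → ℕ → Set
HasLocalCBCover {m} H k =
  Σ (List (Piece m)) λ L →
    All (IsCBSubgraph H) L × Covers H L × (∀ (v : Fin m) → load v L ≤ k)

IsLocalCBCoveringNumber : ∀ {m} → Graph m → ℕ → Set
IsLocalCBCoveringNumber H k =
  HasLocalCBCover H k × (∀ j → HasLocalCBCover H j → k ≤ j)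

-- K*_{n,n} is the bipartite double cover of K_n.  A piece (A , B) of a covering of K_n lifts to the
-- two pieces (A_a , B_b) and (B_a , A_b) of K*_{n,n}; as A and B are disjoint, a vertex lies in at
-- most one of them, so loads do not grow.  Conversely, identifying a_i with b_i collapses a covering
-- of K*_{n,n} onto one of K_n in which the load of i is at most that of a_i plus that of b_i.
-- For K_n itself, give every vertex v the weight 2 ^ (k - load v).  Deleting the first piece (A , B)
-- and splitting the clique into its vertices outside B and those outside A (each part still being
-- covered by the remaining pieces) at least doubles the total weight, so by induction the weights of
-- a k-local covering add up to at most 2 ^ k, a Kraft inequality; hence n ≤ 2 ^ k.  Conversely, the t
-- binary digits of the vertices give t pieces covering K_n whenever n ≤ 2 ^ t.

module Submission where

open import Defs
open import Algebra.Bundles using (CommutativeMonoid)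
import Algebra.Properties.CommutativeSemigroup as CommutativeSemigroupProperties
open import Data.Bool.Base using (Bool; true; false; not; _∨_; if_then_else_; T)
open import Data.Bool.Properties using (∨-identityʳ; ∨-comm; ∨-commutativeMonoid)
open import Data.Empty using (⊥; ⊥-elim)
open import Data.Fin.Patterns using (0F; 1F)
open import Data.Fin.Base using (Fin; zero; suc; splitAt; _↑ˡ_; _↑ʳ_; remQuot; combine; inject≤)
open import Data.Fin.Properties
  using (_≟_; splitAt-↑ˡ; splitAt-↑ʳ; splitAt⁻¹-↑ˡ; splitAt⁻¹-↑ʳ; combine-remQuot; inject≤-injective)
open import Data.Fin.Subset using (Subset; _∈_; _∉_; _∪_) renaming (⊥ to ∅)
open import Data.Fin.Subset.Properties using (_∈?_; ∉⊥; x∈p∪q⁻; x∈p∪q⁺)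
open import Data.List.Base using (List; []; _∷_; length; map; filterᵇ; allFin)
open import Data.List.Properties using (length-filter; length-map; length-tabulate)
open import Data.List.Membership.Propositional using (lose)
open import Data.List.Membership.Propositional.Properties using (∈-map⁺; ∈-allFin)
open import Data.List.Relation.Unary.All as All using (All; []; _∷_)
import Data.List.Relation.Unary.All.Properties as All
open import Data.List.Relation.Unary.AllPairs as AllPairs using (AllPairs; []; _∷_)
import Data.List.Relation.Unary.AllPairs.Properties as AllPairs
open import Data.List.Relation.Unary.Any as Any using (Any; here; there)
import Data.List.Relation.Unary.Any.Properties as Any
open import Data.List.Relation.Unary.Unique.Propositional.Properties using (allFin⁺)
open import Data.Nat.Base using (ℕ; zero; suc; _≤_; _<_; _+_; _*_; _∸_; _^_; z≤n; s≤s)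
open import Data.Nat.ListAction using (sum)
open import Data.Nat.Logarithm using (⌊log₂_⌋; ⌊log₂⌋-mono-≤; ⌊log₂[2^n]⌋≡n)
open import Data.Nat.Properties
  using ( ≤-refl; ≤-trans; ≤-reflexive; <⇒≤; ≰⇒>; 1+n≰n; m≤n+m; +-assoc; +-identityʳ; +-mono-≤; +-monoˡ-≤
        ; *-distribˡ-+; *-cancelˡ-≤; m^n>0; ^-monoʳ-≤; +-∸-assoc; +-commutativeSemigroup; module ≤-Reasoning)
open import Data.Product.Base using (∃-syntax; _×_; _,_; proj₁; proj₂; uncurry)
open import Data.Sum.Base using (_⊎_; inj₁; inj₂; swap)
import Data.Sum.Base as Sum
open import Data.Vec.Base using (lookup; _++_; take; drop; tabulate)
open import Data.Vec.Properties
  using (lookup∘tabulate; lookup-++ˡ; lookup-++ʳ; lookup-replicate; lookup-zipWith; take++drop≡id; []=⇒lookup; lookup⇒[]=)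
open import Function.Base using (id; _∘_)
open import Function.Definitions using (Injective)
open import Relation.Binary.Definitions using (Symmetric; Irreflexive)
open import Relation.Binary.PropositionalEquality
open import Relation.Nullary using (¬_; does; yes; no; contradiction)
open import Relation.Nullary.Decidable using (dec-true; dec-false; T?)

open CommutativeSemigroupProperties +-commutativeSemigroup using () renaming (interchange to +-interchange)
open CommutativeSemigroupProperties (CommutativeMonoid.commutativeSemigroup ∨-commutativeMonoid)
  using () renaming (interchange to ∨-interchange)

AllPairs-filterᵇ : ∀ {A : Set} {R R′ : A → A → Set} (f : A → Bool) →
                   (∀ {u v} → T (f u) → T (f v) → R u v → R′ u v) →
                   ∀ {xs} → AllPairs R xs → AllPairs R′ (filterᵇ f xs)
AllPairs-filterᵇ {R′ = R′} f restrict {xs} pairs =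
  discharge (All.all-filter (T? ∘ f) xs)
            (AllPairs.filter⁺ (T? ∘ f) (AllPairs.map (λ r fu fv → restrict fu fv r) pairs))
  where
  discharge : ∀ {ys} → All (T ∘ f) ys → AllPairs (λ u v → T (f u) → T (f v) → R′ u v) ys →
              AllPairs R′ ys
  discharge []         []           = []
  discharge (fy ∷ fys) (rel ∷ rels) = All.zipWith (λ (fz , r) → r fy fz) (fys , rel) ∷ discharge fys rels

∈-resp-lookup : ∀ {m n} {S : Subset m} {T : Subset n} {u v} →
                lookup S u ≡ lookup T v → u ∈ S → v ∈ T
∈-resp-lookup {S = S} {T} {u} {v} eq u∈S = lookup⇒[]= v T (trans (sym eq) ([]=⇒lookup u∈S))

∈-++ˡ⁺ : ∀ {m n} {S : Subset m} {T : Subset n} {i} → i ∈ S → i ↑ˡ n ∈ S ++ T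
∈-++ˡ⁺ {S = S} {T} {i} = ∈-resp-lookup (sym (lookup-++ˡ S T i))

∈-++ˡ⁻ : ∀ {m n} {S : Subset m} {T : Subset n} {i} → i ↑ˡ n ∈ S ++ T → i ∈ S
∈-++ˡ⁻ {S = S} {T} {i} = ∈-resp-lookup (lookup-++ˡ S T i)

∈-++ʳ⁺ : ∀ {m n} {S : Subset m} {T : Subset n} {i} → i ∈ T → m ↑ʳ i ∈ S ++ T
∈-++ʳ⁺ {S = S} {T} {i} = ∈-resp-lookup (sym (lookup-++ʳ S T i))

∈-++ʳ⁻ : ∀ {m n} {S : Subset m} {T : Subset n} {i} → m ↑ʳ i ∈ S ++ T → i ∈ T
∈-++ʳ⁻ {S = S} {T} {i} = ∈-resp-lookup (lookup-++ʳ S T i)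

does-∈? : ∀ {m} (v : Fin m) (S : Subset m) → does (v ∈? S) ≡ lookup S v
does-∈? v S with lookup S v in eq
... | true  = dec-true (v ∈? S) (lookup⇒[]= v S eq)
... | false = dec-false (v ∈? S) (λ v∈S → contradiction (trans (sym ([]=⇒lookup v∈S)) eq) λ ())

indicator : Bool → ℕ
indicator b = if b then 1 else 0

occurs : ∀ {m} → Fin m → Piece m → Bool
occurs v (A , B) = lookup A v ∨ lookup B v

load-∷ : ∀ {m} (v : Fin m) p L → load v (p ∷ L) ≡ indicator (occurs v p) + load v L
load-∷ v (A , B) L rewrite does-∈? v (A ∪ B) | lookup-zipWith _∨_ v A B with lookup A v ∨ lookup B v
... | true  = refl
... | false = refl

load≤load-∷ : ∀ {m} (v : Fin m) p L → load v L ≤ load v (p ∷ L)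
load≤load-∷ v p L =
  subst (load v L ≤_) (sym (load-∷ v p L)) (m≤n+m (load v L) (indicator (occurs v p)))

load-∷-∷ : ∀ {m} (v : Fin m) p q L →
           load v (p ∷ q ∷ L) ≡ indicator (occurs v p) + indicator (occurs v q) + load v L
load-∷-∷ v p q L = begin
  load v (p ∷ q ∷ L)                                          ≡⟨ load-∷ v p (q ∷ L) ⟩
  indicator (occurs v p) + load v (q ∷ L)                     ≡⟨ cong (indicator (occurs v p) +_) (load-∷ v q L) ⟩
  indicator (occurs v p) + (indicator (occurs v q) + load v L) ≡⟨ +-assoc (indicator (occurs v p)) _ _ ⟨
  indicator (occurs v p) + indicator (occurs v q) + load v L  ∎
  where open ≡-Reasoning

indicator-+-≤-∨ : ∀ x y → (x ≡ true → y ≡ true → ⊥) → indicator x + indicator y ≤ indicator (x ∨ y)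
indicator-+-≤-∨ true  true  x∧y = ⊥-elim (x∧y refl refl)
indicator-+-≤-∨ true  false _   = ≤-refl
indicator-+-≤-∨ false y     _   = ≤-refl

indicator-∨-≤-+ : ∀ x y → indicator (x ∨ y) ≤ indicator x + indicator y
indicator-∨-≤-+ true  y = s≤s z≤n
indicator-∨-≤-+ false y = ≤-refl

SidesDisjoint : ∀ {m} → Piece m → Set
SidesDisjoint {m} (A , B) = ∀ (v : Fin m) → v ∈ A → v ∈ B → ⊥

disjoint-lookup : ∀ {m} {A B : Subset m} → SidesDisjoint (A , B) →
                  ∀ v → lookup A v ≡ true → lookup B v ≡ true → ⊥
disjoint-lookup {A = A} {B} disjoint v a b = disjoint v (lookup⇒[]= v A a) (lookup⇒[]= v B b)

load≤length : ∀ {m} (v : Fin m) L → load v L ≤ length L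
load≤length v L = length-filter (λ p → v ∈? (proj₁ p ∪ proj₂ p)) L

-- The bipartite double cover

module _ {m : ℕ} where

  -- The vertices a_i and b_i are i ↑ˡ m and m ↑ʳ i, and a_i b_j is an edge iff H i j; for symmetric H
  -- this is the bipartite double cover H × K₂.
  DoubleCover : Graph m → Graph (m + m)
  DoubleCover H u v with splitAt m u | splitAt m v
  ... | inj₁ i | inj₂ j = H i j
  ... | inj₂ j | inj₁ i = H i j
  ... | _      | _      = ⊥

  data Copy : Fin (m + m) → Set where
    left  : (i : Fin m) → Copy (i ↑ˡ m)
    right : (i : Fin m) → Copy (m ↑ʳ i)

  copy : (u : Fin (m + m)) → Copy u
  copy u with splitAt m u in eq
  ... | inj₁ i = subst Copy (splitAt⁻¹-↑ˡ eq) (left i)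
  ... | inj₂ i = subst Copy (splitAt⁻¹-↑ʳ eq) (right i)

  origin : ∀ {u} → Copy u → Fin m
  origin (left  i) = i
  origin (right i) = i

  module _ {H : Graph m} {i j : Fin m} where

    DoubleCover-↑ˡ↑ʳ : DoubleCover H (i ↑ˡ m) (m ↑ʳ j) ≡ H i j
    DoubleCover-↑ˡ↑ʳ rewrite splitAt-↑ˡ m i m | splitAt-↑ʳ m m j = refl

    DoubleCover-↑ʳ↑ˡ : DoubleCover H (m ↑ʳ j) (i ↑ˡ m) ≡ H i j
    DoubleCover-↑ʳ↑ˡ rewrite splitAt-↑ˡ m i m | splitAt-↑ʳ m m j = refl

    DoubleCover-↑ˡ↑ˡ : ¬ DoubleCover H (i ↑ˡ m) (j ↑ˡ m)
    DoubleCover-↑ˡ↑ˡ rewrite splitAt-↑ˡ m i m | splitAt-↑ˡ m j m = λ ()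

    DoubleCover-↑ʳ↑ʳ : ¬ DoubleCover H (m ↑ʳ i) (m ↑ʳ j)
    DoubleCover-↑ʳ↑ʳ rewrite splitAt-↑ʳ m m i | splitAt-↑ʳ m m j = λ ()

  crossPiece : Subset m → Subset m → Piece (m + m)
  crossPiece S T = S ++ ∅ , ∅ ++ T

  occurs-crossPiece-↑ˡ : ∀ S T i → occurs (i ↑ˡ m) (crossPiece S T) ≡ lookup S i
  occurs-crossPiece-↑ˡ S T i
    rewrite lookup-++ˡ S (∅ {m}) i | lookup-++ˡ (∅ {m}) T i | lookup-replicate i false = ∨-identityʳ (lookup S i)

  occurs-crossPiece-↑ʳ : ∀ S T i → occurs (m ↑ʳ i) (crossPiece S T) ≡ lookup T i
  occurs-crossPiece-↑ʳ S T i
    rewrite lookup-++ʳ S (∅ {m}) i | lookup-++ʳ (∅ {m}) T i | lookup-replicate i false = refl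

  crossPiece-isCB : ∀ {H : Graph m} {S T} → (∀ i j → i ∈ S → j ∈ T → H i j) →
                    IsCBSubgraph (DoubleCover H) (crossPiece S T)
  crossPiece-isCB {H} {S} {T} edges = disjoint , cross
    where
    disjoint : ∀ u → u ∈ S ++ ∅ → u ∈ ∅ ++ T → ⊥
    disjoint u with copy u
    ... | left  i = λ _ i∈∅ → ∉⊥ (∈-++ˡ⁻ i∈∅)
    ... | right i = λ i∈∅ _ → ∉⊥ (∈-++ʳ⁻ {m} i∈∅)

    cross : ∀ u v → u ∈ S ++ ∅ → v ∈ ∅ ++ T → DoubleCover H u v
    cross u v with copy u | copy v
    ... | left  i | right j = λ i∈S j∈T →
      subst id (sym DoubleCover-↑ˡ↑ʳ) (edges i j (∈-++ˡ⁻ i∈S) (∈-++ʳ⁻ {m} j∈T))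
    ... | left  _ | left  j = λ _ j∈∅ → ⊥-elim (∉⊥ (∈-++ˡ⁻ j∈∅))
    ... | right i | _       = λ i∈∅ _ → ⊥-elim (∉⊥ (∈-++ʳ⁻ {m} i∈∅))

  liftCover : List (Piece m) → List (Piece (m + m))
  liftCover []            = []
  liftCover ((A , B) ∷ L) = crossPiece A B ∷ crossPiece B A ∷ liftCover L

  liftCover-isCB : ∀ {H : Graph m} → Symmetric H → ∀ L →
                   All (IsCBSubgraph H) L → All (IsCBSubgraph (DoubleCover H)) (liftCover L)
  liftCover-isCB H-sym []            []                    = []
  liftCover-isCB H-sym ((A , B) ∷ L) ((_ , edges) ∷ isCBs) =
    crossPiece-isCB edges ∷
    crossPiece-isCB (λ i j i∈B j∈A → H-sym (edges j i j∈A i∈B)) ∷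
    liftCover-isCB H-sym L isCBs

  liftCover-covers-↑ : ∀ {i j} L → Any (EdgeIn i j) L → Any (EdgeIn (i ↑ˡ m) (m ↑ʳ j)) (liftCover L)
  liftCover-covers-↑ (_ ∷ L) (here (inj₁ (i∈A , j∈B))) = here (inj₁ (∈-++ˡ⁺ i∈A , ∈-++ʳ⁺ j∈B))
  liftCover-covers-↑ (_ ∷ L) (here (inj₂ (j∈A , i∈B))) = there (here (inj₁ (∈-++ˡ⁺ i∈B , ∈-++ʳ⁺ j∈A)))
  liftCover-covers-↑ (_ ∷ L) (there ij∈L)              = there (there (liftCover-covers-↑ L ij∈L))

  liftCover-covers : ∀ {H : Graph m} L → Covers H L → Covers (DoubleCover H) (liftCover L)
  liftCover-covers L covers u v with copy u | copy v
  ... | left  i | right j = λ e → liftCover-covers-↑ L (covers i j (subst id DoubleCover-↑ˡ↑ʳ e))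
  ... | right j | left  i = λ e → Any.map swap (liftCover-covers-↑ L (covers i j (subst id DoubleCover-↑ʳ↑ˡ e)))
  ... | left  _ | left  _ = λ e → ⊥-elim (DoubleCover-↑ˡ↑ˡ e)
  ... | right _ | right _ = λ e → ⊥-elim (DoubleCover-↑ʳ↑ʳ e)

  occurs-crossPieces : ∀ {u} (c : Copy u) A B →
    (lookup A (origin c) ≡ true → lookup B (origin c) ≡ true → ⊥) →
    indicator (occurs u (crossPiece A B)) + indicator (occurs u (crossPiece B A))
      ≤ indicator (occurs (origin c) (A , B))
  occurs-crossPieces (left i) A B disjoint
    rewrite occurs-crossPiece-↑ˡ A B i | occurs-crossPiece-↑ˡ B A i = indicator-+-≤-∨ _ _ disjoint
  occurs-crossPieces (right i) A B disjoint
    rewrite occurs-crossPiece-↑ʳ A B i | occurs-crossPiece-↑ʳ B A i | ∨-comm (lookup A i) (lookup B i) =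
    indicator-+-≤-∨ _ _ (λ b a → disjoint a b)

  liftCover-load : ∀ {H : Graph m} L → All (IsCBSubgraph H) L →
                   ∀ {u} (c : Copy u) → load u (liftCover L) ≤ load (origin c) L
  liftCover-load []            []                       c = z≤n
  liftCover-load ((A , B) ∷ L) ((disjoint , _) ∷ isCBs) {u} c = begin
    load u (liftCover ((A , B) ∷ L))
      ≡⟨ load-∷-∷ u (crossPiece A B) (crossPiece B A) (liftCover L) ⟩
    indicator (occurs u (crossPiece A B)) + indicator (occurs u (crossPiece B A)) + load u (liftCover L)
      ≤⟨ +-mono-≤ (occurs-crossPieces c A B (disjoint-lookup disjoint (origin c))) (liftCover-load L isCBs c) ⟩
    indicator (occurs (origin c) (A , B)) + load (origin c) L
      ≡⟨ load-∷ (origin c) (A , B) L ⟨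
    load (origin c) ((A , B) ∷ L) ∎
    where open ≤-Reasoning

  collapse : Subset (m + m) → Subset m
  collapse X = take m X ∪ drop m X

  lookup-take : ∀ (X : Subset (m + m)) i → lookup (take m X) i ≡ lookup X (i ↑ˡ m)
  lookup-take X i = begin
    lookup (take m X) i                    ≡⟨ lookup-++ˡ (take m X) (drop m X) i ⟨
    lookup (take m X ++ drop m X) (i ↑ˡ m) ≡⟨ cong (λ Y → lookup Y (i ↑ˡ m)) (take++drop≡id m X) ⟩
    lookup X (i ↑ˡ m)                      ∎
    where open ≡-Reasoning

  lookup-drop : ∀ (X : Subset (m + m)) i → lookup (drop m X) i ≡ lookup X (m ↑ʳ i)
  lookup-drop X i = begin
    lookup (drop m X) i                    ≡⟨ lookup-++ʳ (take m X) (drop m X) i ⟨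
    lookup (take m X ++ drop m X) (m ↑ʳ i) ≡⟨ cong (λ Y → lookup Y (m ↑ʳ i)) (take++drop≡id m X) ⟩
    lookup X (m ↑ʳ i)                      ∎
    where open ≡-Reasoning

  ∈-collapse⁻ : ∀ {X i} → i ∈ collapse X → i ↑ˡ m ∈ X ⊎ m ↑ʳ i ∈ X
  ∈-collapse⁻ {X} {i} i∈X =
    Sum.map (∈-resp-lookup (lookup-take X i)) (∈-resp-lookup (lookup-drop X i)) (x∈p∪q⁻ _ _ i∈X)

  ∈-collapse⁺ˡ : ∀ {X i} → i ↑ˡ m ∈ X → i ∈ collapse X
  ∈-collapse⁺ˡ {X} {i} a∈X = x∈p∪q⁺ (inj₁ (∈-resp-lookup (sym (lookup-take X i)) a∈X))

  ∈-collapse⁺ʳ : ∀ {X i} → m ↑ʳ i ∈ X → i ∈ collapse X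
  ∈-collapse⁺ʳ {X} {i} b∈X = x∈p∪q⁺ (inj₂ (∈-resp-lookup (sym (lookup-drop X i)) b∈X))

  collapsePiece : Piece (m + m) → Piece m
  collapsePiece (X , Y) = collapse X , collapse Y

  occurs-collapsePiece : ∀ p i → occurs i (collapsePiece p) ≡ occurs (i ↑ˡ m) p ∨ occurs (m ↑ʳ i) p
  occurs-collapsePiece (X , Y) i = begin
    lookup (collapse X) i ∨ lookup (collapse Y) i
      ≡⟨ cong₂ _∨_ (lookup-collapse X) (lookup-collapse Y) ⟩
    (lookup X (i ↑ˡ m) ∨ lookup X (m ↑ʳ i)) ∨ (lookup Y (i ↑ˡ m) ∨ lookup Y (m ↑ʳ i))
      ≡⟨ ∨-interchange (lookup X (i ↑ˡ m)) (lookup X (m ↑ʳ i)) (lookup Y (i ↑ˡ m)) (lookup Y (m ↑ʳ i)) ⟩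
    (lookup X (i ↑ˡ m) ∨ lookup Y (i ↑ˡ m)) ∨ (lookup X (m ↑ʳ i) ∨ lookup Y (m ↑ʳ i)) ∎
    where
    open ≡-Reasoning
    lookup-collapse : ∀ Z → lookup (collapse Z) i ≡ lookup Z (i ↑ˡ m) ∨ lookup Z (m ↑ʳ i)
    lookup-collapse Z =
      trans (lookup-zipWith _∨_ i (take m Z) (drop m Z)) (cong₂ _∨_ (lookup-take Z i) (lookup-drop Z i))

  collapsePiece-isCB : ∀ {H : Graph m} → Symmetric H → Irreflexive _≡_ H →
                       ∀ {p} → IsCBSubgraph (DoubleCover H) p → IsCBSubgraph H (collapsePiece p)
  collapsePiece-isCB {H} H-sym H-irrefl {X , Y} (disjoint , edges) = disjoint′ , edges′
    where
    disjoint′ : ∀ i → i ∈ collapse X → i ∈ collapse Y → ⊥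
    disjoint′ i i∈X i∈Y with ∈-collapse⁻ i∈X | ∈-collapse⁻ i∈Y
    ... | inj₁ a∈X | inj₁ a∈Y = disjoint _ a∈X a∈Y
    ... | inj₁ a∈X | inj₂ b∈Y = H-irrefl refl (subst id DoubleCover-↑ˡ↑ʳ (edges _ _ a∈X b∈Y))
    ... | inj₂ b∈X | inj₁ a∈Y = H-irrefl refl (subst id DoubleCover-↑ʳ↑ˡ (edges _ _ b∈X a∈Y))
    ... | inj₂ b∈X | inj₂ b∈Y = disjoint _ b∈X b∈Y

    edges′ : ∀ i j → i ∈ collapse X → j ∈ collapse Y → H i j
    edges′ i j i∈X j∈Y with ∈-collapse⁻ i∈X | ∈-collapse⁻ j∈Y
    ... | inj₁ a∈X | inj₂ b∈Y = subst id DoubleCover-↑ˡ↑ʳ (edges _ _ a∈X b∈Y)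
    ... | inj₂ b∈X | inj₁ a∈Y = H-sym (subst id DoubleCover-↑ʳ↑ˡ (edges _ _ b∈X a∈Y))
    ... | inj₁ a∈X | inj₁ a∈Y = ⊥-elim (DoubleCover-↑ˡ↑ˡ (edges _ _ a∈X a∈Y))
    ... | inj₂ b∈X | inj₂ b∈Y = ⊥-elim (DoubleCover-↑ʳ↑ʳ (edges _ _ b∈X b∈Y))

  collapsePiece-EdgeIn : ∀ {i j} p → EdgeIn (i ↑ˡ m) (m ↑ʳ j) p → EdgeIn i j (collapsePiece p)
  collapsePiece-EdgeIn _ (inj₁ (a∈X , b∈Y)) = inj₁ (∈-collapse⁺ˡ a∈X , ∈-collapse⁺ʳ b∈Y)
  collapsePiece-EdgeIn _ (inj₂ (b∈X , a∈Y)) = inj₂ (∈-collapse⁺ʳ b∈X , ∈-collapse⁺ˡ a∈Y)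

  collapseCover : List (Piece (m + m)) → List (Piece m)
  collapseCover = map collapsePiece

  collapseCover-isCB : ∀ {H : Graph m} → Symmetric H → Irreflexive _≡_ H →
                       ∀ {L} → All (IsCBSubgraph (DoubleCover H)) L → All (IsCBSubgraph H) (collapseCover L)
  collapseCover-isCB H-sym H-irrefl = All.map⁺ ∘ All.map (collapsePiece-isCB H-sym H-irrefl)

  collapseCover-covers : ∀ {H : Graph m} L → Covers (DoubleCover H) L → Covers H (collapseCover L)
  collapseCover-covers {H} L covers i j e =
    Any.map⁺ (Any.map (collapsePiece-EdgeIn _) (covers _ _ (subst id (sym (DoubleCover-↑ˡ↑ʳ {H = H})) e)))

  collapseCover-load : ∀ L i → load i (collapseCover L) ≤ load (i ↑ˡ m) L + load (m ↑ʳ i) L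
  collapseCover-load []      i = z≤n
  collapseCover-load (p ∷ L) i = begin
    load i (collapseCover (p ∷ L))
      ≡⟨ load-∷ i (collapsePiece p) (collapseCover L) ⟩
    indicator (occurs i (collapsePiece p)) + load i (collapseCover L)
      ≤⟨ +-mono-≤ (≤-trans (≤-reflexive (cong indicator (occurs-collapsePiece p i)))
                           (indicator-∨-≤-+ (occurs a p) (occurs b p)))
                  (collapseCover-load L i) ⟩
    (indicator (occurs a p) + indicator (occurs b p)) + (load a L + load b L)
      ≡⟨ +-interchange (indicator (occurs a p)) _ _ _ ⟩
    (indicator (occurs a p) + load a L) + (indicator (occurs b p) + load b L)
      ≡⟨ cong₂ _+_ (load-∷ a p L) (load-∷ b p L) ⟨
    load a (p ∷ L) + load b (p ∷ L) ∎
    where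
    open ≤-Reasoning
    a b : Fin (m + m)
    a = i ↑ˡ m
    b = m ↑ʳ i

DoubleCover-HasLocalCBCover : ∀ {m} {H : Graph m} {k} → Symmetric H →
                              HasLocalCBCover H k → HasLocalCBCover (DoubleCover H) k
DoubleCover-HasLocalCBCover H-sym (L , isCBs , covers , bounded) =
  liftCover L , liftCover-isCB H-sym L isCBs , liftCover-covers L covers ,
  λ u → ≤-trans (liftCover-load L isCBs (copy u)) (bounded _)

HasLocalCBCover-fromDoubleCover : ∀ {m} {H : Graph m} {k} → Symmetric H → Irreflexive _≡_ H →
                                  HasLocalCBCover (DoubleCover H) k → HasLocalCBCover H (2 * k)
HasLocalCBCover-fromDoubleCover {k = k} H-sym H-irrefl (L , isCBs , covers , bounded) =
  collapseCover L , collapseCover-isCB H-sym H-irrefl isCBs , collapseCover-covers L covers ,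
  λ i → ≤-trans (collapseCover-load L i)
          (≤-trans (+-mono-≤ (bounded _) (bounded _)) (≤-reflexive (cong (k +_) (sym (+-identityʳ k)))))

Kstar≡DoubleCover-K : ∀ n u v → Kstar n u v ≡ DoubleCover (K n) u v
Kstar≡DoubleCover-K n u v with splitAt n u | splitAt n v
... | inj₁ _ | inj₁ _ = refl
... | inj₁ _ | inj₂ _ = refl
... | inj₂ _ | inj₁ _ = refl
... | inj₂ _ | inj₂ _ = refl

HasLocalCBCover-resp : ∀ {m} {H H′ : Graph m} {k} → (∀ u v → H u v ≡ H′ u v) →
                       HasLocalCBCover H k → HasLocalCBCover H′ k
HasLocalCBCover-resp H≡H′ (L , isCBs , covers , bounded) =
  L , All.map isCB isCBs , (λ u v e → covers u v (subst id (sym (H≡H′ u v)) e)) , bounded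
  where
  isCB : ∀ {p} → IsCBSubgraph _ p → IsCBSubgraph _ p
  isCB (disjoint , edges) = disjoint , λ u v u∈A v∈B → subst id (H≡H′ u v) (edges u v u∈A v∈B)

Kstar-HasLocalCBCover : ∀ {n k} → HasLocalCBCover (K n) k → HasLocalCBCover (Kstar n) k
Kstar-HasLocalCBCover {n} =
  HasLocalCBCover-resp (λ u v → sym (Kstar≡DoubleCover-K n u v)) ∘ DoubleCover-HasLocalCBCover ≢-sym

K-HasLocalCBCover-fromKstar : ∀ {n k} → HasLocalCBCover (Kstar n) k → HasLocalCBCover (K n) (2 * k)
K-HasLocalCBCover-fromKstar {n} =
  HasLocalCBCover-fromDoubleCover ≢-sym (λ i≡j i≢j → i≢j i≡j) ∘ HasLocalCBCover-resp (Kstar≡DoubleCover-K n)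

-- A Kraft inequality for cliques

module _ {m : ℕ} where

  Separated : List (Piece m) → Fin m → Fin m → Set
  Separated L u v = Any (EdgeIn u v) L

  outside : Subset m → Fin m → Bool
  outside A v = not (lookup A v)

  T-outside : ∀ {A v} → T (outside A v) → v ∉ A
  T-outside t v∈A = subst (T ∘ not) ([]=⇒lookup v∈A) t

  Separated-outside₂ : ∀ {A B L u v} → T (outside B u) → T (outside B v) →
                       Separated ((A , B) ∷ L) u v → Separated L u v
  Separated-outside₂ _  v∉B (here (inj₁ (_ , v∈B))) = ⊥-elim (T-outside v∉B v∈B)
  Separated-outside₂ u∉B _  (here (inj₂ (_ , u∈B))) = ⊥-elim (T-outside u∉B u∈B)
  Separated-outside₂ _  _   (there separated)       = separated

  Separated-outside₁ : ∀ {A B L u v} → T (outside A u) → T (outside A v) →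
                       Separated ((A , B) ∷ L) u v → Separated L u v
  Separated-outside₁ u∉A _  (here (inj₁ (u∈A , _))) = ⊥-elim (T-outside u∉A u∈A)
  Separated-outside₁ _  v∉A (here (inj₂ (v∈A , _))) = ⊥-elim (T-outside v∉A v∈A)
  Separated-outside₁ _  _   (there separated)       = separated

  -- The subtraction never truncates where it matters: all vertices considered have load at most K.
  weight : ℕ → List (Piece m) → List (Fin m) → ℕ
  weight K L S = sum (map (λ v → 2 ^ (K ∸ load v L)) S)

  weight-filterᵇ-∷ : ∀ K L (f : Fin m → Bool) v S →
    weight K L (filterᵇ f (v ∷ S)) ≡ (if f v then 2 ^ (K ∸ load v L) else 0) + weight K L (filterᵇ f S)
  weight-filterᵇ-∷ K L f v S with f v
  ... | true  = refl
  ... | false = refl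

  -- A vertex in one side of the piece gains a unit of load and survives in only one of the two parts;
  -- a vertex outside the piece survives in both.
  weight-split-vertex : ∀ K l x y → indicator (x ∨ y) + l ≤ K → (x ≡ true → y ≡ true → ⊥) →
    2 * 2 ^ (K ∸ (indicator (x ∨ y) + l))
      ≡ (if not y then 2 ^ (K ∸ l) else 0) + (if not x then 2 ^ (K ∸ l) else 0)
  weight-split-vertex K l true  true  _   x∧y = ⊥-elim (x∧y refl refl)
  weight-split-vertex K l true  false l<K _   = trans (cong (2 ^_) (sym (+-∸-assoc 1 l<K))) (sym (+-identityʳ _))
  weight-split-vertex K l false true  l<K _   = cong (2 ^_) (sym (+-∸-assoc 1 l<K))
  weight-split-vertex K l false false _   _   = cong (2 ^ (K ∸ l) +_) (+-identityʳ _)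

  weight-split : ∀ K A B L S → SidesDisjoint (A , B) → All (λ v → load v ((A , B) ∷ L) ≤ K) S →
    2 * weight K ((A , B) ∷ L) S ≤ weight K L (filterᵇ (outside B) S) + weight K L (filterᵇ (outside A) S)
  weight-split K A B L []      _        []           = z≤n
  weight-split K A B L (v ∷ S) disjoint (v≤K ∷ S≤K) = begin
    2 * weight K ((A , B) ∷ L) (v ∷ S)
      ≡⟨ *-distribˡ-+ 2 (2 ^ (K ∸ load v ((A , B) ∷ L))) _ ⟩
    2 * 2 ^ (K ∸ load v ((A , B) ∷ L)) + 2 * weight K ((A , B) ∷ L) S
      ≤⟨ +-mono-≤ (≤-reflexive vertex) (weight-split K A B L S disjoint S≤K) ⟩
    (inB + inA) + (weight K L (filterᵇ (outside B) S) + weight K L (filterᵇ (outside A) S))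
      ≡⟨ +-interchange inB inA _ _ ⟩
    (inB + weight K L (filterᵇ (outside B) S)) + (inA + weight K L (filterᵇ (outside A) S))
      ≡⟨ cong₂ _+_ (weight-filterᵇ-∷ K L (outside B) v S) (weight-filterᵇ-∷ K L (outside A) v S) ⟨
    weight K L (filterᵇ (outside B) (v ∷ S)) + weight K L (filterᵇ (outside A) (v ∷ S)) ∎
    where
    open ≤-Reasoning
    inA inB : ℕ
    inA = if outside A v then 2 ^ (K ∸ load v L) else 0
    inB = if outside B v then 2 ^ (K ∸ load v L) else 0
    vertex : 2 * 2 ^ (K ∸ load v ((A , B) ∷ L)) ≡ inB + inA
    vertex = trans (cong (λ l → 2 * 2 ^ (K ∸ l)) (load-∷ v (A , B) L))
                   (weight-split-vertex K (load v L) (lookup A v) (lookup B v)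
                     (subst (_≤ K) (load-∷ v (A , B) L) v≤K) (disjoint-lookup disjoint v))

  weight≤2^ : ∀ K L S → All SidesDisjoint L → All (λ v → load v L ≤ K) S → AllPairs (Separated L) S →
              weight K L S ≤ 2 ^ K
  weight≤2^ K []            []          _ _ _              = z≤n
  weight≤2^ K []            (v ∷ [])    _ _ _              = ≤-reflexive (+-identityʳ _)
  weight≤2^ K []            (_ ∷ _ ∷ _) _ _ ((() ∷ _) ∷ _)
  weight≤2^ K ((A , B) ∷ L) S (disjoint ∷ disjoints) S≤K separated = *-cancelˡ-≤ 2 (begin
    2 * weight K ((A , B) ∷ L) S
      ≤⟨ weight-split K A B L S disjoint S≤K ⟩
    weight K L (filterᵇ (outside B) S) + weight K L (filterᵇ (outside A) S)
      ≤⟨ +-mono-≤ (half (outside B) Separated-outside₂) (half (outside A) Separated-outside₁) ⟩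
    2 ^ K + 2 ^ K
      ≡⟨ cong (2 ^ K +_) (+-identityʳ (2 ^ K)) ⟨
    2 * 2 ^ K ∎)
    where
    open ≤-Reasoning
    half : ∀ f → (∀ {u v} → T (f u) → T (f v) → Separated ((A , B) ∷ L) u v → Separated L u v) →
           weight K L (filterᵇ f S) ≤ 2 ^ K
    half f restrict =
      weight≤2^ K L (filterᵇ f S) disjoints
        (All.filter⁺ (T? ∘ f) (All.map (λ {v} → ≤-trans (load≤load-∷ v (A , B) L)) S≤K))
        (AllPairs-filterᵇ {R = Separated ((A , B) ∷ L)} {R′ = Separated L} f restrict separated)

  length≤weight : ∀ K L S → length S ≤ weight K L S
  length≤weight K L []      = z≤n
  length≤weight K L (v ∷ S) = +-mono-≤ (m^n>0 2 (K ∸ load v L)) (length≤weight K L S)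

  clique-length≤2^load : ∀ {H : Graph m} {L K S} → All (IsCBSubgraph H) L → Covers H L →
                         All (λ v → load v L ≤ K) S → AllPairs H S → length S ≤ 2 ^ K
  clique-length≤2^load {L = L} {K} {S} isCBs covers S≤K clique =
    ≤-trans (length≤weight K L S)
            (weight≤2^ K L S (All.map proj₁ isCBs) S≤K (AllPairs.map (covers _ _) clique))

K-HasLocalCBCover⇒≤2^ : ∀ {n k} → HasLocalCBCover (K n) k → n ≤ 2 ^ k
K-HasLocalCBCover⇒≤2^ {n} (L , isCBs , covers , bounded) =
  subst (_≤ _) (length-tabulate id)
    (clique-length≤2^load isCBs covers (All.tabulate (λ {v} _ → bounded v)) (allFin⁺ n))

-- Separating binary codes

Separating : ∀ {m t} → (Fin m → Fin t → Fin 2) → Set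
Separating code = ∀ {u v} → u ≢ v → ∃[ p ] code u p ≢ code v p

Separating-comap : ∀ {m n t} {code : Fin m → Fin t → Fin 2} (f : Fin n → Fin m) →
                   Injective _≡_ _≡_ f → Separating code → Separating (code ∘ f)
Separating-comap f f-injective separating u≢v = separating (u≢v ∘ f-injective)

module _ {m t : ℕ} (code : Fin m → Fin t → Fin 2) where

  fiber : Fin t → Fin 2 → Subset m
  fiber p d = tabulate (λ v → does (code v p ≟ d))

  ∈-fiber⁺ : ∀ {v p d} → code v p ≡ d → v ∈ fiber p d
  ∈-fiber⁺ {v} {p} {d} eq = lookup⇒[]= v (fiber p d) (trans (lookup∘tabulate _ v) (dec-true (code v p ≟ d) eq))

  ∈-fiber⁻ : ∀ {v p d} → v ∈ fiber p d → code v p ≡ d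
  ∈-fiber⁻ {v} {p} {d} v∈ with code v p ≟ d
  ... | yes eq = eq
  ... | no ¬eq = contradiction
    (trans (sym (dec-false (code v p ≟ d) ¬eq)) (trans (sym (lookup∘tabulate _ v)) ([]=⇒lookup v∈))) λ ()

  codePiece : Fin t → Piece m
  codePiece p = fiber p 0F , fiber p 1F

  codePiece-isCB : ∀ p → IsCBSubgraph (K m) (codePiece p)
  codePiece-isCB p =
    (λ v v∈₀ v∈₁ → 0≢1 (trans (sym (∈-fiber⁻ v∈₀)) (∈-fiber⁻ v∈₁))) ,
    (λ u v u∈₀ v∈₁ u≡v →
       0≢1 (trans (sym (∈-fiber⁻ u∈₀)) (subst (λ w → code w p ≡ 1F) (sym u≡v) (∈-fiber⁻ v∈₁))))
    where
    0≢1 : 0F ≢ 1F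
    0≢1 ()

  codePiece-EdgeIn : ∀ {u v} p → code u p ≢ code v p → EdgeIn u v (codePiece p)
  codePiece-EdgeIn {u} {v} p differ with code u p in cu | code v p in cv
  ... | 0F | 1F = inj₁ (∈-fiber⁺ cu , ∈-fiber⁺ cv)
  ... | 1F | 0F = inj₂ (∈-fiber⁺ cv , ∈-fiber⁺ cu)
  ... | 0F | 0F = ⊥-elim (differ refl)
  ... | 1F | 1F = ⊥-elim (differ refl)

  codeCover : List (Piece m)
  codeCover = map codePiece (allFin t)

  codeCover-HasLocalCBCover : Separating code → HasLocalCBCover (K m) t
  codeCover-HasLocalCBCover separating =
    codeCover ,
    All.map⁺ (All.tabulate (λ {p} _ → codePiece-isCB p)) ,
    (λ u v u≢v → let (p , differ) = separating u≢v in
                 lose (∈-map⁺ codePiece (∈-allFin p)) (codePiece-EdgeIn p differ)) ,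
    λ v → ≤-trans (load≤length v codeCover)
                  (≤-reflexive (trans (length-map codePiece (allFin t)) (length-tabulate id)))

digits : ∀ t → Fin (2 ^ t) → Fin t → Fin 2
digits (suc t) x zero    = proj₁ (remQuot {2} (2 ^ t) x)
digits (suc t) x (suc p) = digits t (proj₂ (remQuot {2} (2 ^ t) x)) p

remQuot-injective : ∀ {n} k {x y : Fin (n * k)} → remQuot {n} k x ≡ remQuot k y → x ≡ y
remQuot-injective {n} k {x} {y} eq =
  trans (sym (combine-remQuot {n} k x)) (trans (cong (uncurry combine) eq) (combine-remQuot {n} k y))

digits-separating : ∀ t → Separating (digits t)
digits-separating zero    {zero} {zero} x≢y = ⊥-elim (x≢y refl)
digits-separating (suc t) {x} {y} x≢y with proj₁ (remQuot {2} (2 ^ t) x) ≟ proj₁ (remQuot {2} (2 ^ t) y)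
... | no  d≢ = zero , d≢
... | yes d≡ with digits-separating t (λ r≡ → x≢y (remQuot-injective {2} (2 ^ t) (cong₂ _,_ d≡ r≡)))
...   | p , differ = suc p , differ

≤2^⇒K-HasLocalCBCover : ∀ {n t} → n ≤ 2 ^ t → HasLocalCBCover (K n) t
≤2^⇒K-HasLocalCBCover {t = t} n≤2^t =
  codeCover-HasLocalCBCover _
    (Separating-comap (λ v → inject≤ v n≤2^t) (inject≤-injective n≤2^t n≤2^t _ _) (digits-separating t))

≤2^⇒⌊log₂⌋≤ : ∀ {n k} → n ≤ 2 ^ k → ⌊log₂ n ⌋ ≤ k
≤2^⇒⌊log₂⌋≤ {n} {k} n≤2^k = subst (⌊log₂ n ⌋ ≤_) (⌊log₂[2^n]⌋≡n k) (⌊log₂⌋-mono-≤ n≤2^k)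

n<2^[1+⌊log₂n⌋] : ∀ n → n < 2 ^ suc ⌊log₂ n ⌋
n<2^[1+⌊log₂n⌋] n = ≰⇒> λ 2^≤n →
  1+n≰n (subst (_≤ ⌊log₂ n ⌋) (⌊log₂[2^n]⌋≡n (suc ⌊log₂ n ⌋)) (⌊log₂⌋-mono-≤ 2^≤n))

n≤2^[2*⌊log₂n⌋] : ∀ {n} → 2 ≤ n → n ≤ 2 ^ (2 * ⌊log₂ n ⌋)
n≤2^[2*⌊log₂n⌋] {n} 2≤n = ≤-trans (<⇒≤ (n<2^[1+⌊log₂n⌋] n)) (^-monoʳ-≤ 2 1+log≤2*log)
  where
  log = ⌊log₂ n ⌋
  1≤log : 1 ≤ log
  1≤log = subst (_≤ log) (⌊log₂[2^n]⌋≡n 1) (⌊log₂⌋-mono-≤ 2≤n)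
  1+log≤2*log : suc log ≤ 2 * log
  1+log≤2*log = subst (suc log ≤_) (cong (log +_) (sym (+-identityʳ log))) (+-monoˡ-≤ log 1≤log)

proposition7 :
    ((n : ℕ) → 1 ≤ n → (a b : ℕ) →
      IsLocalCBCoveringNumber (Kstar n) a →
      IsLocalCBCoveringNumber (K n) b →
      (a ≤ b × b ≤ 2 * a))
    ×
    (∃[ c ] ∃[ N ] ((n : ℕ) → N ≤ n → (a : ℕ) →
      IsLocalCBCoveringNumber (Kstar n) a →
      (⌊log₂ n ⌋ ≤ c * a × a ≤ c * ⌊log₂ n ⌋)))
proposition7 =
  (λ n _ a b (coverA , minimalA) (coverB , minimalB) →
    minimalA b (Kstar-HasLocalCBCover coverB) ,
    minimalB (2 * a) (K-HasLocalCBCover-fromKstar coverA)) ,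
  (2 , 2 , λ n 2≤n a (coverA , minimalA) →
    ≤2^⇒⌊log₂⌋≤ (K-HasLocalCBCover⇒≤2^ (K-HasLocalCBCover-fromKstar coverA)) ,
    minimalA (2 * ⌊log₂ n ⌋) (Kstar-HasLocalCBCover (≤2^⇒K-HasLocalCBCover (n≤2^[2*⌊log₂n⌋] 2≤n))))
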